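{- Let $r\ge 1$, $n\ge 0$, $s\ge 0$ be integers with $s\le \frac{r-n-1}{2}$. Then $$F_{r+n}(s+n)=\sum_{k=0}^{n}\binom{n}{k}(-1)^{n-k}F_{r+2k}(s+k).$$
   Context: The incomplete Fibonacci numbers are $F_m(j)=\sum_{i=0}^{j}\binom{m-1-i}{i}$ for integers $m\ge 1$ and $0\le j\le \left[\frac{m-1}{2}\right]$, where $[x]$ denotes the integer part of $x$. -}

module Defs where

open import Data.Nat using (ℕ; zero; suc; _+_; _*_; _∸_)
open import Data.Nat.Combinatorics using (_C_)
open import Data.Integer using (ℤ; +_; -_)
import Data.Integer as ℤ

sumTo : ℕ → (ℕ → ℕ) → ℕ
sumTo zero f = f 0
sumTo (suc j) f = sumTo j f + f (suc j)

sumToℤ : ℕ → (ℕ → ℤ) → ℤ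
sumToℤ zero f = f 0
sumToℤ (suc j) f = sumToℤ j f ℤ.+ f (suc j)

-- Within the paper's range (m ≥ 1, j ≤ ⌊(m-1)/2⌋) we have m-1-i ≥ i ≥ 0,
-- so truncated subtraction agrees with integer subtraction there.
F : ℕ → ℕ → ℕ
F m j = sumTo j (λ i → (m ∸ 1 ∸ i) C i)

signℤ : ℕ → ℤ
signℤ zero = + 1
signℤ (suc k) = - signℤ k

-- Pascal's rule gives F_{m+2}(j+1) = F_{m+1}(j+1) + F_m(j) for m ≥ 1, so the diagonal
-- h_{r,s}(n) = F_{r+n}(s+n) satisfies h_{r,s}(n+1) = h_{r+2,s+1}(n) − h_{r,s}(n).
-- The right-hand side is the n-th forward difference Δⁿg(0) of g(k) = F_{r+2k}(s+k),
-- and Δⁿ⁺¹g(0) = Δⁿ(g ∘ suc)(0) − Δⁿg(0); as passing from (r, s) to (r+2, s+1)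
-- replaces g by g ∘ suc, both sides obey the same recursion in n.
module Submission where

open import Defs
open import Data.Nat using (ℕ; zero; suc; _+_; _*_; _∸_; _≤_; z≤n; s≤s)
open import Data.Nat.Combinatorics using (_C_; nCk+nC[k+1]≡[n+1]C[k+1]; k>n⇒nCk≡0)
import Data.Nat.Properties as ℕ
open import Data.Nat.Tactic.RingSolver using (solve-∀)
open import Data.Integer using (ℤ; +_; -_)
import Data.Integer as ℤ
import Data.Integer.Properties as ℤ
import Data.Integer.Tactic.RingSolver as ℤ-Solver
open import Data.Sum using (inj₁; inj₂)
open import Function using (_∘_)
open import Relation.Binary.PropositionalEquality
open ≡-Reasoning

sumTo-cong : ∀ j {f g : ℕ → ℕ} → (∀ i → f i ≡ g i) → sumTo j f ≡ sumTo j g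
sumTo-cong zero    f≗g = f≗g 0
sumTo-cong (suc j) f≗g = cong₂ _+_ (sumTo-cong j f≗g) (f≗g (suc j))

sumTo-suc : ∀ j f → sumTo (suc j) f ≡ f 0 + sumTo j (f ∘ suc)
sumTo-suc zero    f = refl
sumTo-suc (suc j) f = begin
  sumTo (suc j) f + f (2 + j)                   ≡⟨ cong (_+ f (2 + j)) (sumTo-suc j f) ⟩
  f 0 + sumTo j (f ∘ suc) + f (2 + j)           ≡⟨ ℕ.+-assoc (f 0) _ _ ⟩
  f 0 + sumTo (suc j) (f ∘ suc)                 ∎

sumTo-+ : ∀ j f g → sumTo j (λ i → f i + g i) ≡ sumTo j f + sumTo j g
sumTo-+ zero    f g = refl
sumTo-+ (suc j) f g = begin
  sumTo j (λ i → f i + g i) + (f (suc j) + g (suc j))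
    ≡⟨ cong (_+ (f (suc j) + g (suc j))) (sumTo-+ j f g) ⟩
  sumTo j f + sumTo j g + (f (suc j) + g (suc j))
    ≡⟨ interchange (sumTo j f) (sumTo j g) _ _ ⟩
  sumTo j f + f (suc j) + (sumTo j g + g (suc j)) ∎
  where
  interchange : ∀ a b c d → a + b + (c + d) ≡ a + c + (b + d)
  interchange = solve-∀

sumToℤ-cong : ∀ j {f g : ℕ → ℤ} → (∀ i → f i ≡ g i) → sumToℤ j f ≡ sumToℤ j g
sumToℤ-cong zero    f≗g = f≗g 0
sumToℤ-cong (suc j) f≗g = cong₂ ℤ._+_ (sumToℤ-cong j f≗g) (f≗g (suc j))

sumToℤ-suc : ∀ j f → sumToℤ (suc j) f ≡ f 0 ℤ.+ sumToℤ j (f ∘ suc)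
sumToℤ-suc zero    f = refl
sumToℤ-suc (suc j) f = begin
  sumToℤ (suc j) f ℤ.+ f (2 + j)                  ≡⟨ cong (ℤ._+ f (2 + j)) (sumToℤ-suc j f) ⟩
  f 0 ℤ.+ sumToℤ j (f ∘ suc) ℤ.+ f (2 + j)        ≡⟨ ℤ.+-assoc (f 0) _ _ ⟩
  f 0 ℤ.+ sumToℤ (suc j) (f ∘ suc)                ∎

sumToℤ-- : ∀ j f g → sumToℤ j (λ i → f i ℤ.- g i) ≡ sumToℤ j f ℤ.- sumToℤ j g
sumToℤ-- zero    f g = refl
sumToℤ-- (suc j) f g = begin
  sumToℤ j (λ i → f i ℤ.- g i) ℤ.+ (f (suc j) ℤ.- g (suc j))
    ≡⟨ cong (ℤ._+ (f (suc j) ℤ.- g (suc j))) (sumToℤ-- j f g) ⟩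
  sumToℤ j f ℤ.- sumToℤ j g ℤ.+ (f (suc j) ℤ.- g (suc j))
    ≡⟨ interchange (sumToℤ j f) (sumToℤ j g) _ _ ⟩
  sumToℤ (suc j) f ℤ.- sumToℤ (suc j) g ∎
  where
  interchange : ∀ a b c d → a ℤ.- b ℤ.+ (c ℤ.- d) ≡ a ℤ.+ c ℤ.- (b ℤ.+ d)
  interchange = ℤ-Solver.solve-∀

-- Truncated subtraction makes both sides 0 once i > m, so no range hypothesis is needed.
pascal-∸ : ∀ m i → (suc m ∸ i) C suc i ≡ (m ∸ i) C i + (m ∸ i) C suc i
pascal-∸ m i with ℕ.≤-<-connex i m
... | inj₁ i≤m rewrite ℕ.+-∸-assoc 1 i≤m = sym (nCk+nC[k+1]≡[n+1]C[k+1] (m ∸ i) i)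
... | inj₂ m<i rewrite ℕ.m≤n⇒m∸n≡0 m<i | ℕ.m≤n⇒m∸n≡0 (ℕ.<⇒≤ m<i) with i | m<i
...   | suc _ | _ = refl

F-recurrence : ∀ m j → 1 ≤ m → F (2 + m) (suc j) ≡ F (1 + m) (suc j) + F m j
F-recurrence (suc m) j _ = begin
  F (3 + m) (suc j)                                        ≡⟨ sumTo-suc j _ ⟩
  1 + sumTo j (λ i → (suc m ∸ i) C suc i)                  ≡⟨ cong suc (sumTo-cong j (pascal-∸ m)) ⟩
  1 + sumTo j (λ i → (m ∸ i) C i + (m ∸ i) C suc i)        ≡⟨ cong suc (sumTo-+ j _ _) ⟩
  1 + (F (suc m) j + sumTo j (λ i → (m ∸ i) C suc i))      ≡⟨ cong suc (ℕ.+-comm (F (suc m) j) _) ⟩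
  1 + (sumTo j (λ i → (m ∸ i) C suc i) + F (suc m) j)      ≡⟨ cong (_+ F (suc m) j) (sumTo-suc j _) ⟨
  F (2 + m) (suc j) + F (suc m) j                          ∎

F-recurrenceℤ : ∀ m j → 1 ≤ m → + F (1 + m) (suc j) ≡ + F (2 + m) (suc j) ℤ.- + F m j
F-recurrenceℤ m j 1≤m = begin
  + F (1 + m) (suc j)                                    ≡⟨ cancel (+ F (1 + m) (suc j)) (+ F m j) ⟩
  (+ F (1 + m) (suc j) ℤ.+ + F m j) ℤ.- + F m j          ≡⟨ cong (ℤ._- + F m j) (ℤ.pos-+ _ (F m j)) ⟨
  + (F (1 + m) (suc j) + F m j) ℤ.- + F m j              ≡⟨ cong (λ x → + x ℤ.- + F m j) (F-recurrence m j 1≤m) ⟨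
  + F (2 + m) (suc j) ℤ.- + F m j                        ∎
  where
  cancel : ∀ a b → a ≡ a ℤ.+ b ℤ.- b
  cancel = ℤ-Solver.solve-∀

differenceCoefficient : ℕ → ℕ → ℤ
differenceCoefficient n k = + (n C k) ℤ.* signℤ (n ∸ k)

iteratedDifference : ℕ → (ℕ → ℤ) → ℤ
iteratedDifference n g = sumToℤ n (λ k → differenceCoefficient n k ℤ.* g k)

iteratedDifference-cong : ∀ n {f g : ℕ → ℤ} → (∀ k → f k ≡ g k) →
  iteratedDifference n f ≡ iteratedDifference n g
iteratedDifference-cong n f≗g = sumToℤ-cong n (λ k → cong (ℤ._*_ (differenceCoefficient n k)) (f≗g k))

differenceCoefficient-suc-zero : ∀ n →
  differenceCoefficient (suc n) 0 ≡ - differenceCoefficient n 0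
differenceCoefficient-suc-zero n = sym (ℤ.neg-distribʳ-* (+ 1) (signℤ n))

differenceCoefficient-suc : ∀ n → differenceCoefficient n (suc n) ≡ + 0
differenceCoefficient-suc n rewrite k>n⇒nCk≡0 (ℕ.n<1+n n) = refl

C[k+1]-signℤ[n∸k]≡-differenceCoefficient : ∀ n k →
  + (n C suc k) ℤ.* signℤ (n ∸ k) ≡ - differenceCoefficient n (suc k)
C[k+1]-signℤ[n∸k]≡-differenceCoefficient n k with ℕ.≤-<-connex n k
... | inj₁ n≤k rewrite k>n⇒nCk≡0 (s≤s n≤k) = refl
... | inj₂ k<n rewrite ℕ.+-∸-assoc 1 k<n =
  sym (ℤ.neg-distribʳ-* (+ (n C suc k)) (signℤ (n ∸ suc k)))

differenceCoefficient-suc-suc : ∀ n k →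
  differenceCoefficient (suc n) (suc k) ≡ differenceCoefficient n k ℤ.- differenceCoefficient n (suc k)
differenceCoefficient-suc-suc n k = begin
  + (suc n C suc k) ℤ.* signℤ (n ∸ k)
    ≡⟨ cong (λ c → + c ℤ.* signℤ (n ∸ k)) (nCk+nC[k+1]≡[n+1]C[k+1] n k) ⟨
  + (n C k + n C suc k) ℤ.* signℤ (n ∸ k)
    ≡⟨ cong (ℤ._* signℤ (n ∸ k)) (ℤ.pos-+ (n C k) (n C suc k)) ⟩
  (+ (n C k) ℤ.+ + (n C suc k)) ℤ.* signℤ (n ∸ k)
    ≡⟨ ℤ.*-distribʳ-+ (signℤ (n ∸ k)) (+ (n C k)) (+ (n C suc k)) ⟩
  differenceCoefficient n k ℤ.+ + (n C suc k) ℤ.* signℤ (n ∸ k)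
    ≡⟨ cong (ℤ._+_ (differenceCoefficient n k)) (C[k+1]-signℤ[n∸k]≡-differenceCoefficient n k) ⟩
  differenceCoefficient n k ℤ.- differenceCoefficient n (suc k) ∎

iteratedDifference-peel : ∀ n g → iteratedDifference n g
  ≡ differenceCoefficient n 0 ℤ.* g 0 ℤ.+ sumToℤ n (λ k → differenceCoefficient n (suc k) ℤ.* g (suc k))
iteratedDifference-peel n g = begin
  iteratedDifference n g
    ≡⟨ ℤ.+-identityʳ _ ⟨
  iteratedDifference n g ℤ.+ + 0 ℤ.* g (suc n)
    ≡⟨ cong (λ c → iteratedDifference n g ℤ.+ c ℤ.* g (suc n)) (differenceCoefficient-suc n) ⟨
  sumToℤ (suc n) (λ k → differenceCoefficient n k ℤ.* g k)
    ≡⟨ sumToℤ-suc n _ ⟩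
  differenceCoefficient n 0 ℤ.* g 0 ℤ.+ sumToℤ n (λ k → differenceCoefficient n (suc k) ℤ.* g (suc k)) ∎

iteratedDifference-suc : ∀ n g →
  iteratedDifference (suc n) g ≡ iteratedDifference n (g ∘ suc) ℤ.- iteratedDifference n g
iteratedDifference-suc n g = begin
  iteratedDifference (suc n) g
    ≡⟨ sumToℤ-suc n _ ⟩
  c (suc n) 0 ℤ.* g 0 ℤ.+ sumToℤ n (λ k → c (suc n) (suc k) ℤ.* g (suc k))
    ≡⟨ cong₂ ℤ._+_ (cong (ℤ._* g 0) (differenceCoefficient-suc-zero n)) (sumToℤ-cong n split) ⟩
  - c n 0 ℤ.* g 0 ℤ.+ sumToℤ n (λ k → c n k ℤ.* g (suc k) ℤ.- c n (suc k) ℤ.* g (suc k))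
    ≡⟨ cong (ℤ._+_ (- c n 0 ℤ.* g 0)) (sumToℤ-- n _ _) ⟩
  - c n 0 ℤ.* g 0 ℤ.+ (iteratedDifference n (g ∘ suc) ℤ.- tail)
    ≡⟨ regroup (c n 0) (g 0) (iteratedDifference n (g ∘ suc)) tail ⟩
  iteratedDifference n (g ∘ suc) ℤ.- (c n 0 ℤ.* g 0 ℤ.+ tail)
    ≡⟨ cong (ℤ._-_ (iteratedDifference n (g ∘ suc))) (iteratedDifference-peel n g) ⟨
  iteratedDifference n (g ∘ suc) ℤ.- iteratedDifference n g ∎
  where
  c : ℕ → ℕ → ℤ
  c = differenceCoefficient
  tail : ℤ
  tail = sumToℤ n (λ k → c n (suc k) ℤ.* g (suc k))
  split : ∀ k → c (suc n) (suc k) ℤ.* g (suc k) ≡ c n k ℤ.* g (suc k) ℤ.- c n (suc k) ℤ.* g (suc k)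
  split k = trans (cong (ℤ._* g (suc k)) (differenceCoefficient-suc-suc n k))
                  (distrib (c n k) (c n (suc k)) (g (suc k)))
    where
    distrib : ∀ a b x → (a ℤ.- b) ℤ.* x ≡ a ℤ.* x ℤ.- b ℤ.* x
    distrib = ℤ-Solver.solve-∀
  regroup : ∀ a x y z → - a ℤ.* x ℤ.+ (y ℤ.- z) ≡ y ℤ.- (a ℤ.* x ℤ.+ z)
  regroup = ℤ-Solver.solve-∀

F-diagonal : ∀ n r s → 1 ≤ r →
  + F (r + n) (s + n) ≡ iteratedDifference n (λ k → + F (r + 2 * k) (s + k))
F-diagonal zero    r s _   = sym (ℤ.*-identityˡ _)
F-diagonal (suc n) r s 1≤r = begin
  + F (r + suc n) (s + suc n)
    ≡⟨ cong₂ (λ a b → + F a b) (ℕ.+-suc r n) (ℕ.+-suc s n) ⟩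
  + F (1 + (r + n)) (suc (s + n))
    ≡⟨ F-recurrenceℤ (r + n) (s + n) (ℕ.≤-trans 1≤r (ℕ.m≤m+n r n)) ⟩
  + F (2 + r + n) (suc s + n) ℤ.- + F (r + n) (s + n)
    ≡⟨ cong₂ ℤ._-_ (F-diagonal n (2 + r) (suc s) (s≤s z≤n)) (F-diagonal n r s 1≤r) ⟩
  iteratedDifference n (λ k → + F (2 + r + 2 * k) (suc s + k)) ℤ.- iteratedDifference n g
    ≡⟨ cong (ℤ._- iteratedDifference n g) (iteratedDifference-cong n shift) ⟩
  iteratedDifference n (g ∘ suc) ℤ.- iteratedDifference n g
    ≡⟨ iteratedDifference-suc n g ⟨
  iteratedDifference (suc n) g ∎
  where
  g : ℕ → ℤ
  g k = + F (r + 2 * k) (s + k)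
  shift : ∀ k → + F (2 + r + 2 * k) (suc s + k) ≡ g (suc k)
  shift k = cong₂ (λ a b → + F a b) (index r k) (sym (ℕ.+-suc s k))
    where
    index : ∀ r k → 2 + r + 2 * k ≡ r + 2 * suc k
    index = solve-∀

mainTheorem7 : (r n s : ℕ) → 1 ≤ r → 2 * s + n + 1 ≤ r →
    + F (r + n) (s + n)
      ≡ sumToℤ n (λ k → (+ (n C k) ℤ.* signℤ (n ∸ k)) ℤ.* + F (r + 2 * k) (s + k))
mainTheorem7 r n s 1≤r _ = F-diagonal n r s 1≤r
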